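{- If $R$ is an SMLL${}^0$ net in normal form for $\to$, then $R$ contains no cut links.
   Context: SMLL formulas: $A ::= 1 \mid \bot \mid X \mid X^\bot \mid A\otimes A \mid A ⅋ A$ (⅋ is "par"), involutive negation with $1^\bot=\bot$, $(A\otimes B)^\bot=A^\bot ⅋ B^\bot$. Positive formulas $P ::= 1 \mid P\otimes P$; negative $N ::= \bot \mid N ⅋ N$. SMLL${}^0$ is the unit-free fragment of SMLL: structures built only from axiom, cut, $\otimes$, ⅋ links and $n$-ary sync links (the $i$-th premiss and $i$-th conclusion of a sync link share a positive or negative type; in-edges are positive premisses and negative conclusions, out-edges positive conclusions and negative premisses); there are no one/bot links and no boxes ($1,\bot$ only appear as axiom conclusions). Such a structure is a net if it has no cyclic switching path (undirected simple path using at most one premiss of each ⅋ link and at most one out-edge of each sync link). Reduction $\to$: axiom/cut elimination; $\otimes$/⅋ cut replaced by two cuts; a sync link acting on a conclusion $A\otimes B$ (resp. $A ⅋ B$) of a $\otimes$ (resp. ⅋) link is pushed above it, acting on $A$ and $B$; a sync on a positive conclusion $P$ of an axiom moves to the other conclusion $P^\bot$; a sync on a premiss $P^\bot$ of a cut moves to the other premiss $P$. -}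

module Defs where

open import Data.Nat using (ℕ; zero; suc; _≤_)
open import Data.Nat.DivMod using (_%_; m%n<n)
open import Data.Fin using (Fin; toℕ; fromℕ<; _≟_)
open import Data.List using (List; []; _∷_; _++_; tabulate; concatMap; allFin)
open import Data.List.Membership.Propositional using (_∈_)
open import Data.Product using (_×_; Σ)
open import Data.Sum using (_⊎_)
open import Data.Unit using (⊤)
open import Relation.Nullary using (¬_; yes; no)
open import Relation.Binary.PropositionalEquality using (_≡_)
open import Function.Definitions using (Injective)

infixr 7 _⊗_
infixr 6 _⅋_

data Formula : Set where
  one bot   : Formula
  var nvar  : ℕ → Formula
  _⊗_ _⅋_   : Formula → Formula → Formula

_ᗮ : Formula → Formula
one ᗮ      = bot
bot ᗮ      = one
var X ᗮ    = nvar X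
nvar X ᗮ   = var X
(A ⊗ B) ᗮ  = (A ᗮ) ⅋ (B ᗮ)
(A ⅋ B) ᗮ  = (A ᗮ) ⊗ (B ᗮ)

data Pos : Formula → Set where
  one : Pos one
  _⊗_ : ∀ {P Q} → Pos P → Pos Q → Pos (P ⊗ Q)

data Neg : Formula → Set where
  bot : Neg bot
  _⅋_ : ∀ {N M} → Neg N → Neg M → Neg (N ⅋ M)

-- Links of SMLL⁰ (no one/bot links, no boxes); edges are Fin E

data Link (E : ℕ) : Set where
  ax   : (c₁ c₂ : Fin E) → Link E
  cut  : (p₁ p₂ : Fin E) → Link E
  tens : (p₁ p₂ c : Fin E) → Link E
  par  : (p₁ p₂ c : Fin E) → Link E
  sync : (n : ℕ) (ps cs : Fin n → Fin E) → Link E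

data Kind : Set where
  kAx kCut kTens kPar kSync : Kind

kind : ∀ {E} → Link E → Kind
kind (ax _ _)       = kAx
kind (cut _ _)      = kCut
kind (tens _ _ _)   = kTens
kind (par _ _ _)    = kPar
kind (sync _ _ _)   = kSync

prems : ∀ {E} → Link E → List (Fin E)
prems (ax _ _)        = []
prems (cut a b)       = a ∷ b ∷ []
prems (tens a b _)    = a ∷ b ∷ []
prems (par a b _)     = a ∷ b ∷ []
prems (sync _ ps _)   = tabulate ps

concls : ∀ {E} → Link E → List (Fin E)
concls (ax a b)       = a ∷ b ∷ []
concls (cut _ _)      = []
concls (tens _ _ c)   = c ∷ []
concls (par _ _ c)    = c ∷ []
concls (sync _ _ cs)  = tabulate cs

LinkTyped : ∀ {E} → (Fin E → Formula) → Link E → Set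
LinkTyped τ (ax a b)       = τ b ≡ τ a ᗮ
LinkTyped τ (cut a b)      = τ b ≡ τ a ᗮ
LinkTyped τ (tens a b c)   = τ c ≡ τ a ⊗ τ b
LinkTyped τ (par a b c)    = τ c ≡ τ a ⅋ τ b
LinkTyped τ (sync n ps cs) =
  ∀ i → (τ (cs i) ≡ τ (ps i)) × (Pos (τ (ps i)) ⊎ Neg (τ (ps i)))

occ : ∀ {E} → Fin E → List (Fin E) → ℕ
occ e []       = 0
occ e (x ∷ xs) with x ≟ e
... | yes _ = suc (occ e xs)
... | no  _ = occ e xs

record Structure : Set where
  field
    E    : ℕ
    type : Fin E → Formula
    L    : ℕ
    link : Fin L → Link E

  allPrems : List (Fin E)
  allPrems = concatMap (λ l → prems (link l)) (allFin L)

  allConcls : List (Fin E)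
  allConcls = concatMap (λ l → concls (link l)) (allFin L)

open Structure public

record WellFormed (S : Structure) : Set where
  field
    conclOnce : ∀ e → occ e (allConcls S) ≡ 1
    premAtMostOnce : ∀ e → occ e (allPrems S) ≤ 1
    typed : ∀ l → LinkTyped (type S) (link S l)

data Role : Set where
  prem concl : Role

flipRole : Role → Role
flipRole prem  = concl
flipRole concl = prem

Attached : (S : Structure) → Fin (L S) → Fin (E S) → Role → Set
Attached S l e prem  = e ∈ prems (link S l)
Attached S l e concl = e ∈ concls (link S l)

OutEdge : (S : Structure) → Fin (E S) → Role → Set
OutEdge S e concl = Pos (type S e)
OutEdge S e prem  = Neg (type S e)

allowedAt : (S : Structure) → Link (E S) → Fin (E S) → Role → Fin (E S) → Role → Set
allowedAt S (par _ _ _)    e r e' r' = ¬ ((r ≡ prem) × (r' ≡ prem))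
allowedAt S (sync _ _ _)   e r e' r' = ¬ (OutEdge S e r × OutEdge S e' r')
allowedAt S (ax _ _)       e r e' r' = ⊤
allowedAt S (cut _ _)      e r e' r' = ⊤
allowedAt S (tens _ _ _)   e r e' r' = ⊤

next : ∀ {k} → Fin (suc k) → Fin (suc k)
next {k} i = fromℕ< (m%n<n (suc (toℕ i)) (suc k))

-- A cyclic switching path: a closed undirected simple path
-- node 0 --edge 0-- node 1 --edge 1-- ... node k --edge k-- node 0
-- (pairwise distinct nodes, pairwise distinct edges) which, at each link
-- it crosses, does not use two premisses of a ⅋ link nor two out-edges
-- of a sync link.
record SwitchingCycle (S : Structure) : Set where
  field
    k       : ℕ
    node    : Fin (suc k) → Fin (L S)
    edge    : Fin (suc k) → Fin (E S)
    role    : Fin (suc k) → Role   -- role of edge i at node i (the other end has the flipped role)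
    nodeInj : Injective _≡_ _≡_ node
    edgeInj : Injective _≡_ _≡_ edge
    leaves  : ∀ i → Attached S (node i) (edge i) (role i)
    arrives : ∀ i → Attached S (node (next i)) (edge i) (flipRole (role i))
    switch  : ∀ i → allowedAt S (link S (node (next i)))
                       (edge i) (flipRole (role i))
                       (edge (next i)) (role (next i))

record IsNet (S : Structure) : Set where
  field
    wellFormed : WellFormed S
    acyclic    : ¬ SwitchingCycle S

-- Redexes of →  (left-hand sides of the reduction rules)

data Redex (S : Structure) : Set where
  axCut : (a c : Fin (L S)) (e : Fin (E S)) →
    kind (link S a) ≡ kAx → kind (link S c) ≡ kCut →
    e ∈ concls (link S a) → e ∈ prems (link S c) → Redex S
  tensParCut : (c t p : Fin (L S)) (e e' : Fin (E S)) →
    kind (link S c) ≡ kCut → kind (link S t) ≡ kTens → kind (link S p) ≡ kPar →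
    e ∈ concls (link S t) → e' ∈ concls (link S p) →
    e ∈ prems (link S c) → e' ∈ prems (link S c) → Redex S
  syncMult : (t s : Fin (L S)) (e : Fin (E S)) →
    (kind (link S t) ≡ kTens ⊎ kind (link S t) ≡ kPar) → kind (link S s) ≡ kSync →
    e ∈ concls (link S t) → e ∈ prems (link S s) → Redex S
  syncAx : (a s : Fin (L S)) (e : Fin (E S)) →
    kind (link S a) ≡ kAx → kind (link S s) ≡ kSync →
    e ∈ concls (link S a) → Pos (type S e) → e ∈ prems (link S s) → Redex S
  syncCut : (s c : Fin (L S)) (e : Fin (E S)) →
    kind (link S s) ≡ kSync → kind (link S c) ≡ kCut →
    e ∈ concls (link S s) → Neg (type S e) → e ∈ prems (link S c) → Redex S

NormalForm : Structure → Set
NormalForm S = ¬ Redex S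

-- A cut in normal form cannot have an axiom above either premiss, nor a sync
-- link above a negative premiss, nor a ⊗ above one premiss and a ⅋ above the
-- other; typing rules out two ⊗ or two ⅋. What remains is a sync link above a
-- positive premiss. Such a link has a positive premiss in turn, whose
-- concluder can again only be a sync link, so climbing from premiss to
-- concluder never stops. In a finite structure the climb revisits a link, and
-- the resulting loop is a switching cycle: each sync link on it is entered by
-- a positive conclusion and left by a positive premiss, only one of which is
-- an out-edge.
module Submission where

open import Defs
open import Data.Nat using (ℕ; zero; suc; _+_; _∸_; _≤_; _<_; z≤n; s≤s)
open import Data.Nat.Properties
  using (≤-refl; ≤-trans; <-irrefl; m≤m+n; m≤n+m; +-identityʳ; +-comm; +-suc; +-mono-≤;
         +-monoʳ-<; +-cancelˡ-≡; m+[n∸m]≡n; m<1+n⇒m<n∨m≡n; anyUpTo?)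
open import Data.Nat.DivMod using (m%n<n; m<n⇒m%n≡m; n%n≡0)
open import Data.Fin using (Fin; toℕ; _≟_)
open import Data.Fin.Properties using (toℕ-injective; toℕ<n; toℕ-fromℕ<; pigeonhole)
open import Data.List using (List; []; _∷_; _++_; concatMap; allFin; tabulate)
open import Data.List.Relation.Unary.Any using (here; there; satisfied)
open import Data.List.Membership.Propositional using (_∈_)
open import Data.List.Membership.Propositional.Properties
  using (∈-allFin; ∈-tabulate⁺; ∈-tabulate⁻; ∈-concatMap⁻)
open import Data.Product using (Σ; ∃; _×_; _,_; proj₁; proj₂)
open import Data.Sum using (_⊎_; inj₁; inj₂)
open import Data.Empty using (⊥; ⊥-elim)
open import Data.Unit using (tt)
open import Relation.Nullary using (¬_; yes; no)
open import Relation.Binary.Definitions using (DecidableEquality)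
open import Relation.Binary.PropositionalEquality
  using (_≡_; _≢_; refl; sym; trans; cong; subst)

DistinctBelow : {A : Set} → (ℕ → A) → ℕ → Set
DistinctBelow x m = ∀ {a b} → a < m → b < m → x a ≡ x b → a ≡ b

record Loop {A : Set} (x : ℕ → A) : Set where
  field
    start    : ℕ
    k        : ℕ
    distinct : DistinctBelow (λ t → x (start + t)) (suc k)
    closes   : x (start + suc k) ≡ x start

module _ {A : Set} (_≟ᴬ_ : DecidableEquality A) (x : ℕ → A) where

  distinctBelow⊎loop : ∀ m → DistinctBelow x m ⊎ Loop x
  distinctBelow⊎loop zero = inj₁ λ ()
  distinctBelow⊎loop (suc m) with distinctBelow⊎loop m
  ... | inj₂ loop = inj₂ loop
  ... | inj₁ distinct with anyUpTo? (λ a → x a ≟ᴬ x m) m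
  ...   | yes (a , a<m , xa≡xm) = inj₂ record
          { start = a ; k = m ∸ suc a
          ; distinct = λ t< t'< e → +-cancelˡ-≡ a _ _ (distinct (inWindow t<) (inWindow t'<) e)
          ; closes = trans (cong x a+period≡m) (sym xa≡xm)
          }
    where
      a+period≡m : a + suc (m ∸ suc a) ≡ m
      a+period≡m = trans (+-suc a (m ∸ suc a)) (m+[n∸m]≡n a<m)

      inWindow : ∀ {t} → t < suc (m ∸ suc a) → a + t < m
      inWindow t< = subst (a + _ <_) a+period≡m (+-monoʳ-< a t<)
  ...   | no noRepeat = inj₁ distinct′
    where
      distinct′ : DistinctBelow x (suc m)
      distinct′ a< b< e with m<1+n⇒m<n∨m≡n a< | m<1+n⇒m<n∨m≡n b<
      ... | inj₁ a<m  | inj₁ b<m  = distinct a<m b<m e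
      ... | inj₁ a<m  | inj₂ refl = ⊥-elim (noRepeat (_ , a<m , e))
      ... | inj₂ refl | inj₁ b<m  = ⊥-elim (noRepeat (_ , b<m , sym e))
      ... | inj₂ refl | inj₂ refl = refl

loop : ∀ {n} (x : ℕ → Fin n) → Loop x
loop {n} x with distinctBelow⊎loop _≟_ x (suc n)
... | inj₂ l = l
... | inj₁ distinct with pigeonhole ≤-refl (λ i → x (toℕ i))
...   | i , j , i<j , e = ⊥-elim (<-irrefl (distinct (toℕ<n i) (toℕ<n j) e) i<j)

next-periodic : ∀ {A : Set} {k} (f : ℕ → A) → f (suc k) ≡ f 0 →
                (t : Fin (suc k)) → f (toℕ (next t)) ≡ f (suc (toℕ t))
next-periodic {k = k} f periodic t
  rewrite toℕ-fromℕ< (m%n<n (suc (toℕ t)) (suc k)) with m<1+n⇒m<n∨m≡n (toℕ<n t)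
... | inj₁ t<k  = cong f (m<n⇒m%n≡m (s≤s t<k))
... | inj₂ t≡k rewrite t≡k = trans (cong f (n%n≡0 (suc k))) (sym periodic)

module Occurrences {E : ℕ} (e : Fin E) where

  occ-++ : ∀ xs ys → occ e (xs ++ ys) ≡ occ e xs + occ e ys
  occ-++ []       ys = refl
  occ-++ (x ∷ xs) ys with x ≟ e
  ... | yes _ = cong suc (occ-++ xs ys)
  ... | no  _ = occ-++ xs ys

  ∈⇒1≤occ : ∀ {xs} → e ∈ xs → 1 ≤ occ e xs
  ∈⇒1≤occ {x ∷ xs} e∈ with x ≟ e | e∈
  ... | yes _  | _         = s≤s z≤n
  ... | no x≢e | here e≡x  = ⊥-elim (x≢e (sym e≡x))
  ... | no _   | there e∈′ = ∈⇒1≤occ e∈′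

  1≤occ⇒∈ : ∀ xs → 1 ≤ occ e xs → e ∈ xs
  1≤occ⇒∈ (x ∷ xs) 1≤ with x ≟ e
  ... | yes x≡e = here (sym x≡e)
  ... | no  _   = there (1≤occ⇒∈ xs 1≤)

  module _ {A : Set} (f : A → List (Fin E)) where

    ∈⇒1≤occ-concatMap : ∀ {a} as → a ∈ as → e ∈ f a → 1 ≤ occ e (concatMap f as)
    ∈⇒1≤occ-concatMap (a ∷ as) a∈ e∈ rewrite occ-++ (f a) (concatMap f as) with a∈
    ... | here refl = ≤-trans (∈⇒1≤occ e∈) (m≤m+n _ _)
    ... | there a∈′ = ≤-trans (∈⇒1≤occ-concatMap as a∈′ e∈) (m≤n+m _ _)

    ∈²⇒2≤occ-concatMap : ∀ {a b} as → a ∈ as → b ∈ as → a ≢ b → e ∈ f a → e ∈ f b →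
                         2 ≤ occ e (concatMap f as)
    ∈²⇒2≤occ-concatMap (c ∷ as) a∈ b∈ a≢b e∈a e∈b
      rewrite occ-++ (f c) (concatMap f as) with a∈ | b∈
    ... | here refl | here refl = ⊥-elim (a≢b refl)
    ... | here refl | there b∈′ = +-mono-≤ (∈⇒1≤occ e∈a) (∈⇒1≤occ-concatMap as b∈′ e∈b)
    ... | there a∈′ | here refl =
      subst (2 ≤_) (+-comm (occ e (concatMap f as)) _)
            (+-mono-≤ (∈⇒1≤occ-concatMap as a∈′ e∈a) (∈⇒1≤occ e∈b))
    ... | there a∈′ | there b∈′ =
      ≤-trans (∈²⇒2≤occ-concatMap as a∈′ b∈′ a≢b e∈a e∈b) (m≤n+m _ _)

Pos⇒¬Neg : ∀ {A} → Pos A → ¬ Neg A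
Pos⇒¬Neg one     ()
Pos⇒¬Neg (_ ⊗ _) ()

record UpwardPath (S : Structure) : Set where
  field
    node        : ℕ → Fin (L S)
    edge        : ℕ → Fin (E S)
    premiss     : ∀ m → edge m ∈ prems (link S (node m))
    conclusion  : ∀ m → edge m ∈ concls (link S (node (suc m)))
    nonNegative : ∀ m → ¬ Neg (type S (edge m))

climbing-allowed : ∀ S lk {e e′} → ¬ Neg (type S e′) → allowedAt S lk e concl e′ prem
climbing-allowed S (ax _ _)       _   = tt
climbing-allowed S (cut _ _)      _   = tt
climbing-allowed S (tens _ _ _)   _   = tt
climbing-allowed S (par _ _ _)    _   = λ { (() , _) }
climbing-allowed S (sync _ _ _) ¬neg = λ (_ , neg) → ¬neg neg

module WellFormedStructure {S : Structure} (wf : WellFormed S) where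
  open WellFormed wf

  concluder : ∀ e → ∃ λ l → e ∈ concls (link S l)
  concluder e = satisfied (∈-concatMap⁻ (λ l → concls (link S l)) {xs = allFin (L S)}
    (Occurrences.1≤occ⇒∈ e (allConcls S) (subst (1 ≤_) (sym (conclOnce e)) ≤-refl)))

  premiss-unique : ∀ {e l l′} → e ∈ prems (link S l) → e ∈ prems (link S l′) → l ≡ l′
  premiss-unique {e} {l} {l′} e∈l e∈l′ with l ≟ l′
  ... | yes l≡l′ = l≡l′
  ... | no  l≢l′ = ⊥-elim (<-irrefl refl (≤-trans
        (Occurrences.∈²⇒2≤occ-concatMap e (λ l → prems (link S l)) (allFin (L S))
           (∈-allFin l) (∈-allFin l′) l≢l′ e∈l e∈l′)
        (premAtMostOnce e)))

  typedAt : ∀ {l lk} → link S l ≡ lk → LinkTyped (type S) lk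
  typedAt {l} eq = subst (LinkTyped (type S)) eq (typed l)

  sync-conclusion : ∀ {l n ps cs e} → link S l ≡ sync n ps cs → e ∈ tabulate cs →
                    Σ (Fin n) λ j → type S (ps j) ≡ type S e × (Pos (type S e) ⊎ Neg (type S e))
  sync-conclusion eq e∈ with ∈-tabulate⁻ e∈
  ... | j , refl with typedAt eq j
  ...   | same , polarity = j , sym same , subst (λ A → Pos A ⊎ Neg A) (sym same) polarity

  upwardPath⇒switchingCycle : UpwardPath S → SwitchingCycle S
  upwardPath⇒switchingCycle p = record
    { k       = k
    ; node    = node′
    ; edge    = edge′
    ; role    = λ _ → prem
    ; nodeInj = nodeInj
    ; edgeInj = λ {t} {t′} e → nodeInj (premiss-unique (premiss (start + toℕ t))
                  (subst (_∈ prems (link S (node′ t′))) (sym e) (premiss (start + toℕ t′))))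
    ; leaves  = λ t → premiss (start + toℕ t)
    ; arrives = arrives
    ; switch  = λ t → climbing-allowed S (link S (node′ (next t)))
                         (nonNegative (start + toℕ (next t)))
    }
    where
      open UpwardPath p
      open Loop (loop node)

      node′ : Fin (suc k) → Fin (L S)
      node′ t = node (start + toℕ t)

      edge′ : Fin (suc k) → Fin (E S)
      edge′ t = edge (start + toℕ t)

      nodeInj : ∀ {t t′} → node′ t ≡ node′ t′ → t ≡ t′
      nodeInj {t} {t′} e = toℕ-injective (distinct (toℕ<n t) (toℕ<n t′) e)

      arrives : ∀ t → edge′ t ∈ concls (link S (node′ (next t)))
      arrives t = subst (λ l → edge′ t ∈ concls (link S l)) (sym nextNode) (conclusion (start + toℕ t))
        where
          periodic : node (start + suc k) ≡ node (start + 0)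
          periodic = trans closes (cong node (sym (+-identityʳ start)))

          nextNode : node′ (next t) ≡ node (suc (start + toℕ t))
          nextNode = trans (next-periodic (λ i → node (start + i)) periodic t)
                           (cong node (+-suc start (toℕ t)))

record PositiveSyncPremiss (S : Structure) : Set where
  field
    at       : Fin (L S)
    edge     : Fin (E S)
    isSync   : kind (link S at) ≡ kSync
    premiss  : edge ∈ prems (link S at)
    positive : Pos (type S edge)

data MultiplicativeConcluder (S : Structure) (e : Fin (E S)) : Set where
  ⊗-concluder : ∀ {l p q} → link S l ≡ tens p q e → MultiplicativeConcluder S e
  ⅋-concluder : ∀ {l p q} → link S l ≡ par p q e → MultiplicativeConcluder S e

⊗≢⅋ : ∀ {A B C D : Formula} → A ⊗ B ≢ C ⅋ D
⊗≢⅋ ()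

⅋≢⊗ : ∀ {A B C D : Formula} → A ⅋ B ≢ C ⊗ D
⅋≢⊗ ()

module NormalNet {S : Structure} (net : IsNet S) (nf : NormalForm S) where
  open IsNet net
  open WellFormedStructure wellFormed
  open PositiveSyncPremiss

  ∈-concls : ∀ {l lk e} → link S l ≡ lk → e ∈ concls lk → e ∈ concls (link S l)
  ∈-concls eq = subst (λ lk → _ ∈ concls lk) (sym eq)

  ∈-prems : ∀ {l lk e} → link S l ≡ lk → e ∈ prems lk → e ∈ prems (link S l)
  ∈-prems eq = subst (λ lk → _ ∈ prems lk) (sym eq)

  syncPremiss : ∀ {l n ps cs} → link S l ≡ sync n ps cs → (j : Fin n) → Pos (type S (ps j)) →
                PositiveSyncPremiss S
  syncPremiss {l} eq j pos = record
    { at = l ; edge = _ ; isSync = cong kind eq ; premiss = ∈-prems eq (∈-tabulate⁺ j) ; positive = pos }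

  climb : (u : PositiveSyncPremiss S) → Σ (PositiveSyncPremiss S) λ u′ → edge u ∈ concls (link S (at u′))
  climb u with concluder (edge u)
  ... | l , e∈l with link S l in eq
  ...   | ax _ _ = ⊥-elim (nf (syncAx l (at u) (edge u) (cong kind eq) (isSync u)
                     (∈-concls eq e∈l) (positive u) (premiss u)))
  ...   | tens _ _ _ = ⊥-elim (nf (syncMult l (at u) (edge u) (inj₁ (cong kind eq)) (isSync u)
                     (∈-concls eq e∈l) (premiss u)))
  ...   | par _ _ _ = ⊥-elim (nf (syncMult l (at u) (edge u) (inj₂ (cong kind eq)) (isSync u)
                     (∈-concls eq e∈l) (premiss u)))
  ...   | sync _ _ _ with sync-conclusion eq e∈l
  ...     | j , same , _ = syncPremiss eq j (subst Pos (sym same) (positive u)) , ∈-concls eq e∈l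
  climb u | l , () | cut _ _

  noPositiveSyncPremiss : ¬ PositiveSyncPremiss S
  noPositiveSyncPremiss u = acyclic (upwardPath⇒switchingCycle record
    { node        = λ m → at (climbFrom m)
    ; edge        = λ m → edge (climbFrom m)
    ; premiss     = λ m → premiss (climbFrom m)
    ; conclusion  = λ m → proj₂ (climb (climbFrom m))
    ; nonNegative = λ m → Pos⇒¬Neg (positive (climbFrom m))
    })
    where
      climbFrom : ℕ → PositiveSyncPremiss S
      climbFrom zero    = u
      climbFrom (suc m) = proj₁ (climb (climbFrom m))

  cutPremiss-concluder : ∀ {c e} → kind (link S c) ≡ kCut → e ∈ prems (link S c) →
                         MultiplicativeConcluder S e
  cutPremiss-concluder {c} {e} isCut e∈c with concluder e
  ... | l , e∈l with link S l in eq
  ...   | ax _ _ = ⊥-elim (nf (axCut l c e (cong kind eq) isCut (∈-concls eq e∈l) e∈c))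
  ...   | sync _ _ _ with sync-conclusion eq e∈l
  ...     | j , same , inj₁ pos = ⊥-elim (noPositiveSyncPremiss (syncPremiss eq j (subst Pos (sym same) pos)))
  ...     | _ , _ , inj₂ neg = ⊥-elim (nf (syncCut l c e (cong kind eq) isCut (∈-concls eq e∈l) neg e∈c))
  cutPremiss-concluder isCut e∈c | l , () | cut _ _
  cutPremiss-concluder isCut e∈c | l , here refl | tens _ _ _ = ⊗-concluder eq
  cutPremiss-concluder isCut e∈c | l , here refl | par _ _ _ = ⅋-concluder eq

  noCut : ∀ {c a b} → link S c ≢ cut a b
  noCut {c} {a} {b} eq = clash (cutPremiss-concluder isCut a∈c) (cutPremiss-concluder isCut b∈c)
    where
      isCut : kind (link S c) ≡ kCut
      isCut = cong kind eq

      a∈c : a ∈ prems (link S c)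
      a∈c = ∈-prems eq (here refl)

      b∈c : b ∈ prems (link S c)
      b∈c = ∈-prems eq (there (here refl))

      clash : MultiplicativeConcluder S a → MultiplicativeConcluder S b → ⊥
      clash (⊗-concluder ea) (⊗-concluder eb) =
        ⊗≢⅋ (trans (sym (typedAt eb)) (trans (typedAt eq) (cong _ᗮ (typedAt ea))))
      clash (⅋-concluder ea) (⅋-concluder eb) =
        ⅋≢⊗ (trans (sym (typedAt eb)) (trans (typedAt eq) (cong _ᗮ (typedAt ea))))
      clash (⊗-concluder ea) (⅋-concluder eb) = nf (tensParCut c _ _ a b isCut (cong kind ea) (cong kind eb)
        (∈-concls ea (here refl)) (∈-concls eb (here refl)) a∈c b∈c)
      clash (⅋-concluder ea) (⊗-concluder eb) = nf (tensParCut c _ _ b a isCut (cong kind eb) (cong kind ea)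
        (∈-concls eb (here refl)) (∈-concls ea (here refl)) b∈c a∈c)

mainTheorem6 : (S : Structure) → IsNet S → NormalForm S →
    ∀ (l : Fin (L S)) → kind (link S l) ≢ kCut
mainTheorem6 S net nf l isCut with link S l in eq
... | cut _ _ = NormalNet.noCut net nf eq
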